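{- Let $d\ge2$. Every point of $\mathbb{Q}^{d-1}$ can be written uniquely as $\mathbf{r}=(r_1/q,\dots,r_{d-1}/q)$ with $q$ a positive integer, $r_i$ integers and $\gcd(r_1,\dots,r_{d-1},q)=1$; call $\mathbf{r}$ (and its image in $\mathbb{R}^{d-1}/\mathbb{Z}^{d-1}$) a $q$-torsion point, and $q$ its torsion. For such $\mathbf{r}$ let $$\Lambda(\mathbf{r})=\{(r_1q'-qr_1',\ \dots,\ r_{d-1}q'-qr_{d-1}') : (r_1',\dots,r_{d-1}',q')\in\mathbb{Z}^d\}\subset\mathbb{Z}^{d-1},$$ a full-rank sublattice of $\mathbb{Z}^{d-1}$ depending only on the class of $\mathbf{r}$ modulo $\mathbb{Z}^{d-1}$. Let $Q$ be a positive real number and let $\mathbf{r}$ be a $q$-torsion point in $\mathbb{R}^{d-1}/\mathbb{Z}^{d-1}$. Then the distance in $\mathbb{R}^{d-1}/\mathbb{Z}^{d-1}$ between $\mathbf{r}$ and any distinct torsion point with torsion at most $Q$ is at least $$\frac{1}{qQ}\min\{\|\mathbf{v}\|:\mathbf{v}\in\Lambda(\mathbf{r}),\ \mathbf{v}\ne0\}.$$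
   Formalization: The parameter Q ranges over the positive rationals rather than the positive reals. -}

module Defs where

open import Data.Nat using (ℕ; zero; suc; NonZero)
open import Data.Nat.GCD using (gcd)
open import Data.Integer using (ℤ; +_; ∣_∣)
import Data.Integer as ℤ
open import Data.Rational using (ℚ; 0ℚ; _+_; _*_; _-_; _/_)
open import Data.Fin using (Fin; zero; suc)
open import Data.Product using (∃; ∃₂)
open import Relation.Binary.PropositionalEquality using (_≡_)

Vecℤ : ℕ → Set
Vecℤ n = Fin n → ℤ

Vecℚ : ℕ → Set
Vecℚ n = Fin n → ℚ

gcdAll : ∀ {n} → Vecℤ n → ℕ → ℕ
gcdAll {zero}  r q = q
gcdAll {suc n} r q = gcd ∣ r zero ∣ (gcdAll (λ i → r (suc i)) q)

Primitive : ∀ {n} → Vecℤ n → ℕ → Set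
Primitive r q = gcdAll r q ≡ 1

point : ∀ {n} → Vecℤ n → (q : ℕ) → .{{_ : NonZero q}} → Vecℚ n
point r q i = r i / q

toℚ : ∀ {n} → Vecℤ n → Vecℚ n
toℚ k i = k i / 1

normSq : ∀ {n} → Vecℚ n → ℚ
normSq {zero}  x = 0ℚ
normSq {suc n} x = x zero * x zero + normSq (λ i → x (suc i))

InΛ : ∀ {n} → Vecℤ n → ℕ → Vecℤ n → Set
InΛ {n} r q v = ∃₂ λ (r' : Vecℤ n) (q' : ℤ) →
  ∀ i → v i ≡ r i ℤ.* q' ℤ.- (+ q) ℤ.* r' i

EqModℤ : ∀ {n} → Vecℚ n → Vecℚ n → Set
EqModℤ {n} x y = ∃ λ (k : Vecℤ n) → ∀ i → x i - y i ≡ toℚ k i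

module Submission where

-- Let r/q and s/q' be the two torsion points and put N = q q'.  The integer
-- vector w with w_i = r_i q' - q s_i lies in Λ(r) (take r' = s and q'' = q'),
-- and so does w - N c for every c ∈ ℤ^n (replace r' by s + q' c).  For every
-- integer translate k we have the exact identity
--     N · (r/q - s/q' - k) = w - N k,
-- so the distance between the two points, scaled by N ≤ qQ, is the distance
-- from w to the lattice N ℤ^n.  Choosing c coordinatewise so that v = w - N c
-- has |v_i| ≤ N/2 makes v the shortest vector of w + N ℤ^n; it is nonzero since
-- otherwise the identity with k = c says that the points coincide modulo ℤ^n.
-- Hence ‖v‖² ≤ N² ‖r/q - s/q' - k‖² ≤ (qQ)² ‖r/q - s/q' - k‖² for every k.

open import Defs
open import Data.Nat as ℕ using (ℕ; suc; NonZero)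
import Data.Nat.Properties as ℕP
open import Data.Integer as ℤ using (ℤ; +_; +[1+_]; -[1+_]; ∣_∣)
import Data.Integer.Properties as ℤP
open import Data.Integer.DivMod using (_%ℕ_; _/ℕ_; a≡a%ℕn+[a/ℕn]*n; n%ℕd<d)
open import Data.Integer.Tactic.RingSolver using (solve-∀)
open import Data.Rational as ℚ using (ℚ; 0ℚ; _+_; _*_; _-_; -_; _/_; _≤_; Positive; toℚᵘ)
import Data.Rational.Properties as ℚP
import Data.Rational.Unnormalised as ℚᵘ
import Data.Rational.Unnormalised.Properties as ℚᵘP
import Data.Rational.Solver as ℚSolver
open import Data.Fin using (zero; suc)
open import Data.Product using (∃; _×_; _,_; proj₁; proj₂)
open import Data.Sum using (inj₁; inj₂)
open import Relation.Nullary using (¬_; Dec; yes; no)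
open import Relation.Binary.PropositionalEquality

Centred : ℕ → ℤ → Set
Centred N v = ∣ v ∣ ℕ.+ ∣ v ∣ ℕ.≤ N

-- Every integer w is congruent modulo N to a centred one: with w = t + d N
-- the Euclidean division, take t itself if 2t ≤ N and t - N otherwise.
nearest-multiple : ∀ (w : ℤ) (N : ℕ) .{{_ : NonZero N}} →
                   ∃ λ c → Centred N (w ℤ.- + N ℤ.* c)
nearest-multiple w N = centre (t ℕ.+ t ℕP.≤? N)
  where
  t = w %ℕ N
  d = w /ℕ N
  t<N : t ℕ.< N
  t<N = n%ℕd<d w N

  w-Nd≡t : w ℤ.- + N ℤ.* d ≡ + t
  w-Nd≡t = trans (cong (ℤ._- + N ℤ.* d) (a≡a%ℕn+[a/ℕn]*n w N)) (cancel (+ t) d (+ N))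
    where
    cancel : ∀ t d n → (t ℤ.+ d ℤ.* n) ℤ.- n ℤ.* d ≡ t
    cancel = solve-∀

  w-N[d+1]≡t⊖N : w ℤ.- + N ℤ.* (d ℤ.+ + 1) ≡ t ℤ.⊖ N
  w-N[d+1]≡t⊖N = begin
    w ℤ.- + N ℤ.* (d ℤ.+ + 1)                   ≡⟨ cong (ℤ._- + N ℤ.* (d ℤ.+ + 1)) (a≡a%ℕn+[a/ℕn]*n w N) ⟩
    (+ t ℤ.+ d ℤ.* + N) ℤ.- + N ℤ.* (d ℤ.+ + 1) ≡⟨ cancel (+ t) d (+ N) ⟩
    + t ℤ.- + N                                 ≡⟨ ℤP.m-n≡m⊖n t N ⟩
    t ℤ.⊖ N                                     ∎
    where
    open ≡-Reasoning
    cancel : ∀ t d n → (t ℤ.+ d ℤ.* n) ℤ.- n ℤ.* (d ℤ.+ + 1) ≡ t ℤ.- n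
    cancel = solve-∀

  -- with a = N - t we have a + t = N < 2t, so a < t and 2a ≤ a + t = N
  t⊖N-centred : N ℕ.< t ℕ.+ t → Centred N (t ℤ.⊖ N)
  t⊖N-centred N<2t rewrite ℤP.∣⊖∣-< t<N =
    subst (a ℕ.+ a ℕ.≤_) a+t≡N (ℕP.+-monoʳ-≤ a (ℕP.<⇒≤ a<t))
    where
    a = N ℕ.∸ t
    a+t≡N : a ℕ.+ t ≡ N
    a+t≡N = ℕP.m∸n+n≡m (ℕP.<⇒≤ t<N)
    a<t : a ℕ.< t
    a<t = ℕP.+-cancelʳ-< t a t (subst (ℕ._< t ℕ.+ t) (sym a+t≡N) N<2t)

  centre : Dec (t ℕ.+ t ℕ.≤ N) → ∃ λ c → Centred N (w ℤ.- + N ℤ.* c)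
  centre (yes 2t≤N) = d , subst (Centred N) (sym w-Nd≡t) 2t≤N
  centre (no 2t≰N)  = d ℤ.+ + 1 , subst (Centred N) (sym w-N[d+1]≡t⊖N) (t⊖N-centred (ℕP.≰⇒> 2t≰N))

-- For j ≠ 0:  2|v| ≤ N ≤ |N j| = |(v + N j) - v| ≤ |v + N j| + |v|.
centred-minimal-≢0 : ∀ {N} (v j : ℤ) .{{_ : ℤ.NonZero j}} → Centred N v →
                     ∣ v ∣ ℕ.≤ ∣ v ℤ.+ + N ℤ.* j ∣
centred-minimal-≢0 {N} v j centred = ℕP.+-cancelʳ-≤ (∣ v ∣) (∣ v ∣) (∣ u ∣) (begin
  ∣ v ∣ ℕ.+ ∣ v ∣      ≤⟨ centred ⟩
  N                    ≤⟨ ℕP.m≤m*n N ∣ j ∣ ⟩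
  N ℕ.* ∣ j ∣          ≡⟨ ℤP.∣i*j∣≡∣i∣*∣j∣ (+ N) j ⟨
  ∣ + N ℤ.* j ∣        ≡⟨ cong ∣_∣ (difference v (+ N) j) ⟨
  ∣ u ℤ.- v ∣          ≤⟨ ℤP.∣i-j∣≤∣i∣+∣j∣ u v ⟩
  ∣ u ∣ ℕ.+ ∣ v ∣      ∎)
  where
  open ℕP.≤-Reasoning
  u = v ℤ.+ + N ℤ.* j
  difference : ∀ v n j → (v ℤ.+ n ℤ.* j) ℤ.- v ≡ n ℤ.* j
  difference = solve-∀

centred-minimal : ∀ {N} (v j : ℤ) → Centred N v → ∣ v ∣ ℕ.≤ ∣ v ℤ.+ + N ℤ.* j ∣
centred-minimal {N} v (+ 0) _ rewrite ℤP.*-zeroʳ (+ N) | ℤP.+-identityʳ v = ℕP.≤-refl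
centred-minimal v j@(+[1+ _ ]) = centred-minimal-≢0 v j
centred-minimal v j@(-[1+ _ ]) = centred-minimal-≢0 v j

nearest-multiple-minimal : ∀ w N c k → Centred N (w ℤ.- + N ℤ.* c) →
                           ∣ w ℤ.- + N ℤ.* c ∣ ℕ.≤ ∣ w ℤ.- + N ℤ.* k ∣
nearest-multiple-minimal w N c k centred =
  subst (λ u → ∣ w ℤ.- + N ℤ.* c ∣ ℕ.≤ ∣ u ∣) (regroup w (+ N) c k)
        (centred-minimal (w ℤ.- + N ℤ.* c) (c ℤ.- k) centred)
  where
  regroup : ∀ w n c k → (w ℤ.- n ℤ.* c) ℤ.+ n ℤ.* (c ℤ.- k) ≡ w ℤ.- n ℤ.* k
  regroup = solve-∀

ι : ℤ → ℚ
ι a = a / 1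

-- The normalised fraction i / n agrees with the unnormalised one; this lets
-- us transfer identities through the ring monomorphism toℚᵘ.
toℚᵘ-/ : ∀ i n .{{_ : NonZero n}} → toℚᵘ (i / n) ℚᵘ.≃ (i ℚᵘ./ n)
toℚᵘ-/ i (suc d) = ℚP.toℚᵘ-fromℚᵘ (ℚᵘ.mkℚᵘ i d)

-- ι is a ring homomorphism (checked in ℚᵘ, where ι a is simply a/1) ...
ι-+ : ∀ a b → ι (a ℤ.+ b) ≡ ι a + ι b
ι-+ a b = ℚP.toℚᵘ-injective (begin
  toℚᵘ (ι (a ℤ.+ b))                       ≈⟨ toℚᵘ-/ (a ℤ.+ b) 1 ⟩
  (a ℤ.+ b) ℚᵘ./ 1                         ≈⟨ ℚᵘ.*≡* (fractions a b) ⟩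
  (a ℚᵘ./ 1) ℚᵘ.+ (b ℚᵘ./ 1)               ≈⟨ ℚᵘP.+-cong (toℚᵘ-/ a 1) (toℚᵘ-/ b 1) ⟨
  toℚᵘ (ι a) ℚᵘ.+ toℚᵘ (ι b)               ≈⟨ ℚP.toℚᵘ-homo-+ (ι a) (ι b) ⟨
  toℚᵘ (ι a + ι b)                         ∎)
  where
  open ℚᵘP.≃-Reasoning
  fractions : ∀ a b → (a ℤ.+ b) ℤ.* + 1 ≡ (a ℤ.* + 1 ℤ.+ b ℤ.* + 1) ℤ.* + 1
  fractions = solve-∀

ι-neg : ∀ a → ι (ℤ.- a) ≡ - ι a
ι-neg a = ℚP.toℚᵘ-injective (begin
  toℚᵘ (ι (ℤ.- a))                         ≈⟨ toℚᵘ-/ (ℤ.- a) 1 ⟩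
  (ℤ.- a) ℚᵘ./ 1                           ≈⟨ ℚᵘP.-‿cong (toℚᵘ-/ a 1) ⟨
  ℚᵘ.- toℚᵘ (ι a)                          ≈⟨ ℚP.toℚᵘ-homo‿- (ι a) ⟨
  toℚᵘ (- ι a)                             ∎)
  where open ℚᵘP.≃-Reasoning

ι-* : ∀ a b → ι (a ℤ.* b) ≡ ι a * ι b
ι-* a b = ℚP.toℚᵘ-injective (begin
  toℚᵘ (ι (a ℤ.* b))                       ≈⟨ toℚᵘ-/ (a ℤ.* b) 1 ⟩
  (a ℤ.* b) ℚᵘ./ 1                         ≈⟨ ℚᵘP.*-cong (toℚᵘ-/ a 1) (toℚᵘ-/ b 1) ⟨
  toℚᵘ (ι a) ℚᵘ.* toℚᵘ (ι b)               ≈⟨ ℚP.toℚᵘ-homo-* (ι a) (ι b) ⟨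
  toℚᵘ (ι a * ι b)                         ∎)
  where open ℚᵘP.≃-Reasoning

ι-- : ∀ a b → ι (a ℤ.- b) ≡ ι a - ι b
ι-- a b = trans (ι-+ a (ℤ.- b)) (cong (_+_ (ι a)) (ι-neg b))

ι-ℕ* : ∀ m n → ι (+ (m ℕ.* n)) ≡ ι (+ m) * ι (+ n)
ι-ℕ* m n = trans (cong ι (ℤP.pos-* m n)) (ι-* (+ m) (+ n))

ι-mono : ∀ {a b} → a ℤ.≤ b → ι a ≤ ι b
ι-mono {a} {b} a≤b = ℚP.toℚᵘ-cancel-≤
  (ℚᵘP.≤-respˡ-≃ (ℚᵘP.≃-sym (toℚᵘ-/ a 1)) (ℚᵘP.≤-respʳ-≃ (ℚᵘP.≃-sym (toℚᵘ-/ b 1))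
    (ℚᵘ.*≤* (ℤP.*-monoʳ-≤-nonNeg (+ 1) a≤b))))

ι-nonNeg : ∀ n → 0ℚ ≤ ι (+ n)
ι-nonNeg n = ℚP.nonNegative⁻¹ (ι (+ n)) {{ℚP.normalize-nonNeg n 1}}

ι-ℕ*-bound : ∀ q q' Q → ι (+ q') ≤ Q → ι (+ (q ℕ.* q')) ≤ ι (+ q) * Q
ι-ℕ*-bound q q' Q q'≤Q = subst (_≤ ι (+ q) * Q) (sym (ι-ℕ* q q'))
  (ℚP.*-monoˡ-≤-nonNeg (ι (+ q)) {{ℚ.nonNegative (ι-nonNeg q)}} q'≤Q)

/-*-cancel : ∀ a q .{{_ : NonZero q}} → (a / q) * ι (+ q) ≡ ι a
/-*-cancel a q@(suc d) = ℚP.toℚᵘ-injective (begin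
  toℚᵘ ((a / q) * ι (+ q))                 ≈⟨ ℚP.toℚᵘ-homo-* (a / q) (ι (+ q)) ⟩
  toℚᵘ (a / q) ℚᵘ.* toℚᵘ (ι (+ q))         ≈⟨ ℚᵘP.*-cong (toℚᵘ-/ a q) (toℚᵘ-/ (+ q) 1) ⟩
  (a ℚᵘ./ q) ℚᵘ.* (+ q ℚᵘ./ 1)             ≈⟨ ℚᵘ.*≡* (fractions a d) ⟩
  a ℚᵘ./ 1                                 ≈⟨ toℚᵘ-/ a 1 ⟨
  toℚᵘ (ι a)                               ∎)
  where
  open ℚᵘP.≃-Reasoning
  fractions : ∀ a d → (a ℤ.* + suc d) ℤ.* + 1 ≡ a ℤ.* + suc (d ℕ.* 1)
  fractions a d rewrite ℕP.*-identityʳ d = ℤP.*-identityʳ (a ℤ.* + suc d)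

square-nonNeg : ∀ x → 0ℚ ≤ x * x
square-nonNeg x with ℚP.≤-total 0ℚ x
... | inj₁ 0≤x = ℚP.nonNegative⁻¹ (x * x)
  {{ℚP.nonNeg*nonNeg⇒nonNeg x {{ℚ.nonNegative 0≤x}} x {{ℚ.nonNegative 0≤x}}}}
... | inj₂ x≤0 = ℚP.nonNegative⁻¹ (x * x)
  {{ℚP.nonPos*nonPos⇒nonPos x {{ℚ.nonPositive x≤0}} x {{ℚ.nonPositive x≤0}}}}

square-mono : ∀ {a b} → 0ℚ ≤ a → a ≤ b → a * a ≤ b * b
square-mono {a} {b} 0≤a a≤b = ℚP.≤-trans
  (ℚP.*-monoˡ-≤-nonNeg a {{ℚ.nonNegative 0≤a}} a≤b)
  (ℚP.*-monoʳ-≤-nonNeg b {{ℚ.nonNegative (ℚP.≤-trans 0≤a a≤b)}} a≤b)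

*-cancelˡ-≡-pos : ∀ a .{{_ : Positive a}} {x y} → a * x ≡ a * y → x ≡ y
*-cancelˡ-≡-pos a ax≡ay = ℚP.≤-antisym (ℚP.*-cancelˡ-≤-pos a (ℚP.≤-reflexive ax≡ay))
                                       (ℚP.*-cancelˡ-≤-pos a (ℚP.≤-reflexive (sym ax≡ay)))

square-abs : ∀ i → i ℤ.* i ≡ + (∣ i ∣ ℕ.* ∣ i ∣)
square-abs (+ n)    = sym (ℤP.pos-* n n)
square-abs -[1+ n ] = refl

ι-square-mono : ∀ a b → ∣ a ∣ ℕ.≤ ∣ b ∣ → ι a * ι a ≤ ι b * ι b
ι-square-mono a b ∣a∣≤∣b∣ = begin
  ι a * ι a                 ≡⟨ ι-* a a ⟨
  ι (a ℤ.* a)               ≡⟨ cong ι (square-abs a) ⟩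
  ι (+ (∣ a ∣ ℕ.* ∣ a ∣))   ≤⟨ ι-mono (ℤ.+≤+ (ℕP.*-mono-≤ ∣a∣≤∣b∣ ∣a∣≤∣b∣)) ⟩
  ι (+ (∣ b ∣ ℕ.* ∣ b ∣))   ≡⟨ cong ι (square-abs b) ⟨
  ι (b ℤ.* b)               ≡⟨ ι-* b b ⟩
  ι b * ι b                 ∎
  where open ℚP.≤-Reasoning

normSq-cong : ∀ {n} {x y : Vecℚ n} → (∀ i → x i ≡ y i) → normSq x ≡ normSq y
normSq-cong {ℕ.zero} x≡y = refl
normSq-cong {suc n}  x≡y = cong₂ (λ a b → a * a + b) (x≡y zero) (normSq-cong (λ i → x≡y (suc i)))

normSq-mono : ∀ {n} (x y : Vecℚ n) → (∀ i → x i * x i ≤ y i * y i) → normSq x ≤ normSq y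
normSq-mono {ℕ.zero} x y x≤y = ℚP.≤-refl
normSq-mono {suc n}  x y x≤y = ℚP.+-mono-≤ (x≤y zero) (normSq-mono (λ i → x (suc i)) (λ i → y (suc i)) (λ i → x≤y (suc i)))

normSq-nonNeg : ∀ {n} (x : Vecℚ n) → 0ℚ ≤ normSq x
normSq-nonNeg {ℕ.zero} x = ℚP.≤-refl
normSq-nonNeg {suc n}  x = ℚP.+-mono-≤ (square-nonNeg (x zero)) (normSq-nonNeg (λ i → x (suc i)))

normSq-scale : ∀ {n} (a : ℚ) (x : Vecℚ n) → normSq (λ i → a * x i) ≡ a * a * normSq x
normSq-scale {ℕ.zero} a x = sym (ℚP.*-zeroʳ (a * a))
normSq-scale {suc n}  a x = begin
  (a * x₀) * (a * x₀) + normSq (λ i → a * x (suc i)) ≡⟨ cong (λ t → (a * x₀) * (a * x₀) + t) (normSq-scale a (λ i → x (suc i))) ⟩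
  (a * x₀) * (a * x₀) + a * a * rest                 ≡⟨ distribute a x₀ rest ⟩
  a * a * (x₀ * x₀ + rest)                           ∎
  where
  open ≡-Reasoning
  open ℚSolver.+-*-Solver
  x₀ = x zero
  rest = normSq (λ i → x (suc i))
  distribute : ∀ a x s → (a * x) * (a * x) + a * a * s ≡ a * a * (x * x + s)
  distribute = solve 3 (λ a x s → (a :* x) :* (a :* x) :+ a :* a :* s := a :* a :* (x :* x :+ s)) refl

crossDiff : ∀ {n} → Vecℤ n → ℕ → Vecℤ n → ℕ → Vecℤ n
crossDiff r q s q' i = r i ℤ.* + q' ℤ.- + q ℤ.* s i

crossDiff-shift-∈Λ : ∀ {n} (r : Vecℤ n) q (s : Vecℤ n) q' (c : Vecℤ n) →
                     InΛ r q (λ i → crossDiff r q s q' i ℤ.- + (q ℕ.* q') ℤ.* c i)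
crossDiff-shift-∈Λ r q s q' c = (λ i → s i ℤ.+ + q' ℤ.* c i) , + q' , λ i → begin
  r i ℤ.* + q' ℤ.- + q ℤ.* s i ℤ.- + (q ℕ.* q') ℤ.* c i     ≡⟨ cong (λ N → r i ℤ.* + q' ℤ.- + q ℤ.* s i ℤ.- N ℤ.* c i) (ℤP.pos-* q q') ⟩
  r i ℤ.* + q' ℤ.- + q ℤ.* s i ℤ.- + q ℤ.* + q' ℤ.* c i     ≡⟨ regroup (r i) (s i) (c i) (+ q) (+ q') ⟩
  r i ℤ.* + q' ℤ.- + q ℤ.* (s i ℤ.+ + q' ℤ.* c i)           ∎
  where
  open ≡-Reasoning
  regroup : ∀ r s c a b → r ℤ.* b ℤ.- a ℤ.* s ℤ.- a ℤ.* b ℤ.* c ≡ r ℤ.* b ℤ.- a ℤ.* (s ℤ.+ b ℤ.* c)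
  regroup = solve-∀

module _ {n} (r : Vecℤ n) (q : ℕ) .{{_ : NonZero q}} (s : Vecℤ n) (q' : ℕ) .{{_ : NonZero q'}} where

  private
    N = q ℕ.* q'
    w = crossDiff r q s q'
    instance
      N≢0 : NonZero N
      N≢0 = ℕP.m*n≢0 q q'

  offset : Vecℤ n → Vecℚ n
  offset k i = point r q i - point s q' i - toℚ k i

  scaled-difference : ∀ (k : Vecℤ n) i → ι (+ N) * offset k i ≡ ι (w i ℤ.- + N ℤ.* k i)
  scaled-difference k i = begin
    ι (+ N) * (A - B - K)                             ≡⟨ cong (_* (A - B - K)) (ι-ℕ* q q') ⟩
    ιq * ιq' * (A - B - K)                            ≡⟨ expand A B K ιq ιq' ⟩
    (A * ιq) * ιq' - ιq * (B * ιq') - ιq * ιq' * K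
      ≡⟨ cong₂ (λ a b → a * ιq' - ιq * b - ιq * ιq' * K) (/-*-cancel (r i) q) (/-*-cancel (s i) q') ⟩
    ι (r i) * ιq' - ιq * ι (s i) - ιq * ιq' * K
      ≡⟨ cong₂ (λ a b → a - b - ιq * ιq' * K) (ι-* (r i) (+ q')) (ι-* (+ q) (s i)) ⟨
    ι (r i ℤ.* + q') - ι (+ q ℤ.* s i) - ιq * ιq' * K
      ≡⟨ cong₂ (λ a b → a - b * K) (ι-- (r i ℤ.* + q') (+ q ℤ.* s i)) (ι-ℕ* q q') ⟨
    ι (w i) - ι (+ N) * K                             ≡⟨ cong (_-_ (ι (w i))) (ι-* (+ N) (k i)) ⟨
    ι (w i) - ι (+ N ℤ.* k i)                         ≡⟨ ι-- (w i) (+ N ℤ.* k i) ⟨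
    ι (w i ℤ.- + N ℤ.* k i)                           ∎
    where
    open ≡-Reasoning
    open ℚSolver.+-*-Solver
    ιq = ι (+ q)
    ιq' = ι (+ q')
    A = point r q i
    B = point s q' i
    K = toℚ k i
    expand : ∀ A B K a b → a * b * (A - B - K) ≡ (A * a) * b - a * (B * b) - a * b * K
    expand = solve 5 (λ A B K a b → a :* b :* (A :- B :- K) := (A :* a) :* b :- a :* (B :* b) :- a :* b :* K) refl

  multiple⇒EqModℤ : ∀ (c : Vecℤ n) → (∀ i → w i ℤ.- + N ℤ.* c i ≡ + 0) → EqModℤ (point r q) (point s q')
  multiple⇒EqModℤ c w≡Nc = c , λ i → begin
    point r q i - point s q' i        ≡⟨ regroup (point r q i) (point s q' i) (toℚ c i) ⟩
    offset c i + toℚ c i              ≡⟨ cong (_+ toℚ c i) (offset≡0 i) ⟩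
    0ℚ + toℚ c i                      ≡⟨ ℚP.+-identityˡ (toℚ c i) ⟩
    toℚ c i                           ∎
    where
    open ≡-Reasoning
    instance
      ιN>0 : Positive (ι (+ N))
      ιN>0 = ℚP.normalize-pos N 1
    offset≡0 : ∀ i → offset c i ≡ 0ℚ
    offset≡0 i = *-cancelˡ-≡-pos (ι (+ N))
      (trans (scaled-difference c i) (trans (cong ι (w≡Nc i)) (sym (ℚP.*-zeroʳ (ι (+ N))))))
    regroup : ∀ a b k → a - b ≡ (a - b - k) + k
    regroup = solve 3 (λ a b k → a :- b := (a :- b :- k) :+ k) refl
      where open ℚSolver.+-*-Solver

  centred-bound : ∀ (c : Vecℤ n) → (∀ i → Centred N (w i ℤ.- + N ℤ.* c i)) → ∀ (k : Vecℤ n) →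
                  normSq (toℚ (λ i → w i ℤ.- + N ℤ.* c i)) ≤ ι (+ N) * ι (+ N) * normSq (offset k)
  centred-bound c centred k = begin
    normSq (toℚ (λ i → w i ℤ.- + N ℤ.* c i))  ≤⟨ normSq-mono _ remainder coordinatewise ⟩
    normSq remainder                          ≡⟨ normSq-cong (scaled-difference k) ⟨
    normSq (λ i → ι (+ N) * offset k i)       ≡⟨ normSq-scale (ι (+ N)) (offset k) ⟩
    ι (+ N) * ι (+ N) * normSq (offset k)     ∎
    where
    open ℚP.≤-Reasoning
    remainder : Vecℚ n
    remainder i = ι (w i ℤ.- + N ℤ.* k i)
    coordinatewise : ∀ i → ι (w i ℤ.- + N ℤ.* c i) * ι (w i ℤ.- + N ℤ.* c i) ≤ remainder i * remainder i
    coordinatewise i = ι-square-mono (w i ℤ.- + N ℤ.* c i) (w i ℤ.- + N ℤ.* k i)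
      (nearest-multiple-minimal (w i) N (c i) (k i) (centred i))

lemma3 : (m : ℕ) → (q : ℕ) → .{{_ : NonZero q}} → (r : Vecℤ (suc m)) → Primitive r q →
         (Q : ℚ) → Positive Q →
         (q' : ℕ) → .{{_ : NonZero q'}} → (s : Vecℤ (suc m)) → Primitive s q' →
         (+ q' / 1) ≤ Q →
         ¬ EqModℤ (point r q) (point s q') →
         ∃ λ (v : Vecℤ (suc m)) → InΛ r q v × ¬ (∀ i → v i ≡ + 0) ×
           (∀ (k : Vecℤ (suc m)) →
             normSq (toℚ v) ≤ ((+ q / 1) * Q) * ((+ q / 1) * Q) * normSq (λ i → point r q i - point s q' i - toℚ k i))
lemma3 m q r _ Q _ q' s _ q'≤Q distinct =
  v , crossDiff-shift-∈Λ r q s q' c , (λ v≡0 → distinct (multiple⇒EqModℤ r q s q' c v≡0)) , bound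
  where
  instance
    N≢0 : NonZero (q ℕ.* q')
    N≢0 = ℕP.m*n≢0 q q'
  N = q ℕ.* q'
  w = crossDiff r q s q'
  c : Vecℤ (suc m)
  c i = proj₁ (nearest-multiple (w i) N)
  v : Vecℤ (suc m)
  v i = w i ℤ.- + N ℤ.* c i
  bound : ∀ k → normSq (toℚ v) ≤ (ι (+ q) * Q) * (ι (+ q) * Q) * normSq (offset r q s q' k)
  bound k = ℚP.≤-trans (centred-bound r q s q' c (λ i → proj₂ (nearest-multiple (w i) N)) k)
    (ℚP.*-monoʳ-≤-nonNeg (normSq (offset r q s q' k)) {{ℚ.nonNegative (normSq-nonNeg (offset r q s q' k))}}
      (square-mono (ι-nonNeg N) (ι-ℕ*-bound q q' Q q'≤Q)))
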